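{- Let $G^+=(V,E^+)$ be a finite simple undirected graph, $\phi\ge0$, $0\le\eta<1$, and let $\mathcal{C}^*$ be a clustering with $\mathrm{obj}(\mathcal{C}^*)\le\phi$. Consider any execution of Algorithm ClusterPhi$(G^+,\phi,\eta)$, with $V_{\mathrm{high}}$ and the partition $\mathcal{L}$ of $V_{\mathrm{high}}$ as defined there. Then for every $u\in V_{\mathrm{high}}$, $\mathcal{L}_u\cap V_{\mathrm{high}}=\mathcal{C}^*_u\cap V_{\mathrm{high}}$, where $\mathcal{L}_u$ is the part of $\mathcal{L}$ containing $u$.
   Context: For $u\in V$, $N(u)$ is the set of neighbours of $u$ in $G^+$, $\deg(u)=|N(u)|$, and $N[u]=N(u)\cup\{u\}$. $\Delta$ denotes symmetric difference. A clustering $\mathcal{C}$ is a partition of $V$, and $\mathcal{C}_u$ denotes the cluster containing $u$. The disagreement of $u$ is $\rho_{\mathcal{C}}(u)=|N[u]\Delta\mathcal{C}_u|$, and $\mathrm{obj}(\mathcal{C})=\max_u\rho_{\mathcal{C}}(u)$. An $\eta'$-similarity query $\Delta_{\eta'}(u,v,t)$ returns: - $0$ if $|N[u]\Delta N[v]|>(1+\eta')t$; - $1$ if $|N[u]\Delta N[v]|\le t$; - arbitrarily $0$ or $1$ otherwise. Relevant part of Algorithm ClusterPhi$(G^+,\phi,\eta)$: 1. Let $E'$ be the set of pairs $\{u,v\}$ for which $\Delta_\eta(u,v,2\phi)$ returns $1$. 2. Let $V_{\mathrm{low}}=\{w:\deg(w)\le(3+\eta)\phi\}$ and $V_{\mathrm{high}}=V\setminus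 V_{\mathrm{low}}$. 3. Let $\mathcal{L}$ be the partition of $V_{\mathrm{high}}$ into the connected components of the graph $(V_{\mathrm{high}},E')$.
   Formalization: The parameters φ and η are rational numbers. -}

module Defs where

open import Level using (0ℓ)
open import Data.Nat using (ℕ)
open import Data.Bool using (Bool; true; false; _∨_; _xor_)
open import Data.Fin using (Fin; _≟_)
open import Data.Fin.Subset using (Subset; ∣_∣)
open import Data.Vec using (tabulate; zipWith)
open import Data.Integer using (+_)
open import Data.Rational using (ℚ; _/_; _+_; _*_; _≤_; _<_; 0ℚ; 1ℚ)
open import Relation.Nullary.Decidable using (⌊_⌋)
open import Relation.Binary using (Rel)
import Data.Nat as ℕ
open import Relation.Binary.PropositionalEquality using (_≡_)
open import Data.Product using (_×_)
open import Data.Empty using (⊥)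

record Graph (n : ℕ) : Set where
  field
    adj   : Fin n → Fin n → Bool
    sym   : ∀ u v → adj u v ≡ adj v u
    irrefl : ∀ u → adj u u ≡ false
open Graph public

ℕ→ℚ : ℕ → ℚ
ℕ→ℚ m = + m / 1

_Δ_ : ∀ {n} → Subset n → Subset n → Subset n
p Δ q = zipWith _xor_ p q

module _ {n : ℕ} (G : Graph n) where
  N : Fin n → Subset n
  N u = tabulate (adj G u)

  N[_] : Fin n → Subset n
  N[ u ] = tabulate (λ v → adj G u v ∨ ⌊ v ≟ u ⌋)

  deg : Fin n → ℕ
  deg u = ∣ N u ∣

-- A clustering (partition of V) given by a cluster label for each vertex;
-- C_u = { v | label v = label u }.
Clustering : ℕ → Set
Clustering n = Fin n → ℕ

cluster : ∀ {n} → Clustering n → Fin n → Subset n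
cluster C u = tabulate (λ v → ⌊ C v ℕ.≟ C u ⌋)

ρ : ∀ {n} (G : Graph n) → Clustering n → Fin n → ℕ
ρ G C u = ∣ N[_] G u Δ cluster C u ∣

-- obj(C) ≤ φ  (obj is the maximum of ρ over vertices)
ObjAtMost : ∀ {n} (G : Graph n) → Clustering n → ℚ → Set
ObjAtMost G C φ = ∀ u → ℕ→ℚ (ρ G C u) ≤ φ

nbDiff : ∀ {n} (G : Graph n) → Fin n → Fin n → ℕ
nbDiff G u v = ∣ N[_] G u Δ N[_] G v ∣

-- E' is a possible outcome of step 1 of ClusterPhi: a set of unordered
-- pairs (symmetric relation) whose membership is consistent with the
-- answers of an η-similarity query Δ_η(u,v,2φ) for every pair.
ValidE' : ∀ {n} (G : Graph n) (φ η : ℚ) → Rel (Fin n) 0ℓ → Set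
ValidE' {n} G φ η E' =
  (∀ u v → E' u v → E' v u) ×
  ((∀ u v → ℕ→ℚ (nbDiff G u v) ≤ ℕ→ℚ 2 * φ → E' u v) ×
   (∀ u v → (1ℚ + η) * (ℕ→ℚ 2 * φ) < ℕ→ℚ (nbDiff G u v) → E' u v → ⊥))

High : ∀ {n} (G : Graph n) (φ η : ℚ) → Fin n → Set
High G φ η w = (ℕ→ℚ 3 + η) * φ < ℕ→ℚ (deg G w)

-- Reachability in the graph (V_high, E') starting from a vertex of V_high:
-- every vertex visited after the start lies in V_high.
data Reach {n} (G : Graph n) (φ η : ℚ) (E' : Rel (Fin n) 0ℓ) (u : Fin n)
     : Fin n → Set where
  here : Reach G φ η E' u u
  step : ∀ {v w} → Reach G φ η E' u v → E' v w → High G φ η w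
       → Reach G φ η E' u w

{-# OPTIONS --safe #-}
module Submission where

-- Write d(p, q) = |p Δ q|; it is a metric on subsets, and ρ(u) = d(N[u], C*_u) ≤ φ.
-- If u, v lie in the same cluster, the triangle inequality through that cluster gives
-- d(N[u], N[v]) ≤ 2φ, so uv ∈ E' and a single step reaches v.  If x, y lie in different (hence
-- disjoint) clusters, then |N[x]| + |N[y]| ≤ d(N[x], N[y]) + 2(ρ(x) + ρ(y)); for high-degree x, y
-- this forces d(N[x], N[y]) > 2(3+η)φ - 4φ = (1+η)·2φ, so xy ∉ E' and no path in (V_high, E')
-- leaves a cluster.

open import Defs hiding (sym)
open import Level using (0ℓ)
open import Data.Bool using (Bool; true; false; _∨_)
open import Data.Fin using (Fin; zero)
open import Data.Fin.Subset using (Subset; ∣_∣; _∈_; _∩_; Empty)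
open import Data.Nat as ℕ using (ℕ)
open import Data.Product using (_,_)
open import Function.Bundles using (_⇔_; mk⇔)
open import Relation.Binary using (Rel)
open import Relation.Binary.PropositionalEquality using (_≡_; _≢_; refl; sym; trans; cong; cong₂)

module _ where
  open import Data.Bool.Properties using (xor-comm; xor-identityʳ; T-≡)
  open import Data.Fin.Subset using (⊥; _⊆_)
  open import Data.Fin.Subset.Properties using (drop-∷-Empty; x∈p∩q⁻; p⊆q⇒∣p∣≤∣q∣)
  open import Data.Nat using (suc; _+_; _≤_; _≟_; z≤n; s≤s)
  open import Data.Nat.Properties
    using (≤-trans; ≤-reflexive; +-suc; n≤1+n; +-mono-≤; +-monoʳ-≤; +-commutativeSemigroup; module ≤-Reasoning)
  open import Data.Nat.Solver using (module +-*-Solver)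
  open import Algebra.Properties.CommutativeSemigroup +-commutativeSemigroup
    using () renaming (interchange to +-interchange)
  open import Data.Vec using ([]; _∷_; tabulate)
  open import Data.Vec.Base using (here)
  open import Data.Vec.Properties
    using (zipWith-comm; zipWith-identityʳ; lookup∘tabulate; []=⇒lookup; lookup⇒[]=; tabulate-cong)
  open import Function.Bundles using (Equivalence)
  open import Relation.Binary.PropositionalEquality using (subst₂)
  open import Relation.Nullary using (contradiction)
  open import Relation.Nullary.Decidable using (⌊_⌋; toWitness)

  Δ-comm : ∀ {n} (p q : Subset n) → p Δ q ≡ q Δ p
  Δ-comm = zipWith-comm xor-comm

  ∣pΔr∣≤∣pΔq∣+∣qΔr∣ : ∀ {n} (p q r : Subset n) → ∣ p Δ r ∣ ≤ ∣ p Δ q ∣ + ∣ q Δ r ∣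
  ∣pΔr∣≤∣pΔq∣+∣qΔr∣ []          []          []          = z≤n
  ∣pΔr∣≤∣pΔq∣+∣qΔr∣ (true  ∷ p) (true  ∷ q) (true  ∷ r) = ∣pΔr∣≤∣pΔq∣+∣qΔr∣ p q r
  ∣pΔr∣≤∣pΔq∣+∣qΔr∣ (false ∷ p) (false ∷ q) (false ∷ r) = ∣pΔr∣≤∣pΔq∣+∣qΔr∣ p q r
  ∣pΔr∣≤∣pΔq∣+∣qΔr∣ (true  ∷ p) (false ∷ q) (false ∷ r) = s≤s (∣pΔr∣≤∣pΔq∣+∣qΔr∣ p q r)
  ∣pΔr∣≤∣pΔq∣+∣qΔr∣ (false ∷ p) (true  ∷ q) (true  ∷ r) = s≤s (∣pΔr∣≤∣pΔq∣+∣qΔr∣ p q r)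
  ∣pΔr∣≤∣pΔq∣+∣qΔr∣ (true  ∷ p) (true  ∷ q) (false ∷ r) =
    ≤-trans (s≤s (∣pΔr∣≤∣pΔq∣+∣qΔr∣ p q r)) (≤-reflexive (sym (+-suc _ _)))
  ∣pΔr∣≤∣pΔq∣+∣qΔr∣ (false ∷ p) (false ∷ q) (true  ∷ r) =
    ≤-trans (s≤s (∣pΔr∣≤∣pΔq∣+∣qΔr∣ p q r)) (≤-reflexive (sym (+-suc _ _)))
  ∣pΔr∣≤∣pΔq∣+∣qΔr∣ (true  ∷ p) (false ∷ q) (true  ∷ r) =
    ≤-trans (∣pΔr∣≤∣pΔq∣+∣qΔr∣ p q r) (+-mono-≤ (n≤1+n _) (n≤1+n _))
  ∣pΔr∣≤∣pΔq∣+∣qΔr∣ (false ∷ p) (true  ∷ q) (false ∷ r) =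
    ≤-trans (∣pΔr∣≤∣pΔq∣+∣qΔr∣ p q r) (+-mono-≤ (n≤1+n _) (n≤1+n _))

  ∣p∣≤∣pΔq∣+∣q∣ : ∀ {n} (p q : Subset n) → ∣ p ∣ ≤ ∣ p Δ q ∣ + ∣ q ∣
  ∣p∣≤∣pΔq∣+∣q∣ p q =
    subst₂ (λ p′ q′ → ∣ p′ ∣ ≤ ∣ p Δ q ∣ + ∣ q′ ∣) (Δ-identityʳ p) (Δ-identityʳ q) (∣pΔr∣≤∣pΔq∣+∣qΔr∣ p q ⊥)
    where
    Δ-identityʳ : ∀ {n} (p : Subset n) → p Δ ⊥ ≡ p
    Δ-identityʳ = zipWith-identityʳ xor-identityʳ

  Empty[p∩q]⇒∣pΔq∣≡∣p∣+∣q∣ : ∀ {n} {p q : Subset n} → Empty (p ∩ q) → ∣ p Δ q ∣ ≡ ∣ p ∣ + ∣ q ∣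
  Empty[p∩q]⇒∣pΔq∣≡∣p∣+∣q∣ {p = []}        {[]}        _ = refl
  Empty[p∩q]⇒∣pΔq∣≡∣p∣+∣q∣ {p = true  ∷ p} {true  ∷ q} e = contradiction (zero , here) e
  Empty[p∩q]⇒∣pΔq∣≡∣p∣+∣q∣ {p = true  ∷ p} {false ∷ q} e = cong suc (Empty[p∩q]⇒∣pΔq∣≡∣p∣+∣q∣ (drop-∷-Empty e))
  Empty[p∩q]⇒∣pΔq∣≡∣p∣+∣q∣ {p = false ∷ p} {true  ∷ q} e =
    trans (cong suc (Empty[p∩q]⇒∣pΔq∣≡∣p∣+∣q∣ (drop-∷-Empty e))) (sym (+-suc _ _))
  Empty[p∩q]⇒∣pΔq∣≡∣p∣+∣q∣ {p = false ∷ p} {false ∷ q} e = Empty[p∩q]⇒∣pΔq∣≡∣p∣+∣q∣ (drop-∷-Empty e)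

  ∣p∣+∣q∣≤∣pΔq∣+2[∣pΔr∣+∣qΔs∣] : ∀ {n} (p q r s : Subset n) → Empty (r ∩ s) →
    ∣ p ∣ + ∣ q ∣ ≤ ∣ p Δ q ∣ + ((∣ p Δ r ∣ + ∣ q Δ s ∣) + (∣ p Δ r ∣ + ∣ q Δ s ∣))
  ∣p∣+∣q∣≤∣pΔq∣+2[∣pΔr∣+∣qΔs∣] p q r s r∩s=∅ = begin
    ∣ p ∣ + ∣ q ∣                              ≤⟨ +-mono-≤ (∣p∣≤∣pΔq∣+∣q∣ p r) (∣p∣≤∣pΔq∣+∣q∣ q s) ⟩
    (∣ p Δ r ∣ + ∣ r ∣) + (∣ q Δ s ∣ + ∣ s ∣)    ≡⟨ +-interchange (∣ p Δ r ∣) (∣ r ∣) (∣ q Δ s ∣) (∣ s ∣) ⟩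
    (∣ p Δ r ∣ + ∣ q Δ s ∣) + (∣ r ∣ + ∣ s ∣)    ≡⟨ cong ((∣ p Δ r ∣ + ∣ q Δ s ∣) +_) (Empty[p∩q]⇒∣pΔq∣≡∣p∣+∣q∣ r∩s=∅) ⟨
    (∣ p Δ r ∣ + ∣ q Δ s ∣) + ∣ r Δ s ∣        ≤⟨ +-monoʳ-≤ (∣ p Δ r ∣ + ∣ q Δ s ∣) ∣rΔs∣≤ ⟩
    (∣ p Δ r ∣ + ∣ q Δ s ∣) + (∣ p Δ r ∣ + (∣ p Δ q ∣ + ∣ q Δ s ∣))
      ≡⟨ solve 3 (λ a b d → (a :+ b) :+ (a :+ (d :+ b)) := d :+ ((a :+ b) :+ (a :+ b)))
               refl (∣ p Δ r ∣) (∣ q Δ s ∣) (∣ p Δ q ∣) ⟩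
    ∣ p Δ q ∣ + ((∣ p Δ r ∣ + ∣ q Δ s ∣) + (∣ p Δ r ∣ + ∣ q Δ s ∣)) ∎
    where
    open ≤-Reasoning
    open +-*-Solver using (solve; _:+_; _:=_)
    ∣rΔs∣≤ : ∣ r Δ s ∣ ≤ ∣ p Δ r ∣ + (∣ p Δ q ∣ + ∣ q Δ s ∣)
    ∣rΔs∣≤ = begin
      ∣ r Δ s ∣                          ≤⟨ ∣pΔr∣≤∣pΔq∣+∣qΔr∣ r p s ⟩
      ∣ r Δ p ∣ + ∣ p Δ s ∣              ≤⟨ +-mono-≤ (≤-reflexive (cong ∣_∣ (Δ-comm r p))) (∣pΔr∣≤∣pΔq∣+∣qΔr∣ p q s) ⟩
      ∣ p Δ r ∣ + (∣ p Δ q ∣ + ∣ q Δ s ∣) ∎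

  ∈-tabulate⁻ : ∀ {n} {f : Fin n → Bool} {i} → i ∈ tabulate f → f i ≡ true
  ∈-tabulate⁻ {f = f} {i} i∈ = trans (sym (lookup∘tabulate f i)) ([]=⇒lookup i∈)

  ∈-tabulate⁺ : ∀ {n} {f : Fin n → Bool} {i} → f i ≡ true → i ∈ tabulate f
  ∈-tabulate⁺ {f = f} {i} fi≡true = lookup⇒[]= i _ (trans (lookup∘tabulate f i) fi≡true)

  deg≤∣N[]∣ : ∀ {n} (G : Graph n) u → deg G u ≤ ∣ N[_] G u ∣
  deg≤∣N[]∣ G u = p⊆q⇒∣p∣≤∣q∣ N⊆N[]
    where
    N⊆N[] : N G u ⊆ N[_] G u
    N⊆N[] i∈ = ∈-tabulate⁺ (cong (_∨ _) (∈-tabulate⁻ i∈))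

  module _ {n} {C : Clustering n} where

    ∈-cluster⁻ : ∀ {x i} → i ∈ cluster C x → C i ≡ C x
    ∈-cluster⁻ i∈ = toWitness (Equivalence.from T-≡ (∈-tabulate⁻ i∈))

    cluster-disjoint : ∀ {x y} → C x ≢ C y → Empty (cluster C x ∩ cluster C y)
    cluster-disjoint Cx≢Cy (i , i∈) with x∈p∩q⁻ _ _ i∈
    ... | i∈x , i∈y = Cx≢Cy (trans (sym (∈-cluster⁻ i∈x)) (∈-cluster⁻ i∈y))

    cluster-cong : ∀ {x y} → C x ≡ C y → cluster C x ≡ cluster C y
    cluster-cong Cx≡Cy = tabulate-cong (λ v → cong (λ k → ⌊ C v ≟ k ⌋) Cx≡Cy)

    sameCluster⇒nbDiff≤ρ+ρ : ∀ (G : Graph n) {x y} → C x ≡ C y → nbDiff G x y ≤ ρ G C x + ρ G C y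
    sameCluster⇒nbDiff≤ρ+ρ G {x} {y} Cx≡Cy = begin
      nbDiff G x y                               ≤⟨ ∣pΔr∣≤∣pΔq∣+∣qΔr∣ (N[_] G x) (cluster C x) (N[_] G y) ⟩
      ρ G C x + ∣ cluster C x Δ N[_] G y ∣    ≡⟨ cong (λ c → ρ G C x + ∣ c Δ N[_] G y ∣) (cluster-cong Cx≡Cy) ⟩
      ρ G C x + ∣ cluster C y Δ N[_] G y ∣    ≡⟨ cong (λ c → ρ G C x + ∣ c ∣) (Δ-comm (cluster C y) (N[_] G y)) ⟩
      ρ G C x + ρ G C y                        ∎
      where open ≤-Reasoning

open import Data.Integer as ℤ using (1ℤ)
import Data.Integer.Properties as ℤ
open import Data.Nat.Coprimality using (1-coprimeTo) renaming (sym to coprime-sym)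
open import Data.Rational using (ℚ; mkℚ; toℚᵘ; _+_; _*_; -_; _≤_; _<_; *≤*; 0ℚ; 1ℚ)
open import Data.Rational.Properties
  using ( normalize-coprime; toℚᵘ-injective; toℚᵘ-homo-+; +-assoc; +-inverseʳ; +-identityʳ
        ; +-mono-≤; +-monoʳ-≤; +-mono-<; +-monoˡ-<; <-≤-trans; *-distribʳ-+; *-identityˡ
        ; module ≤-Reasoning)
open import Data.Rational.Solver using (module +-*-Solver)
open import Data.Rational.Unnormalised as ℚᵘ using (mkℚᵘ; *≡*)
open import Data.Rational.Unnormalised.Properties using (module ≃-Reasoning)
open import Relation.Nullary using (¬_)
open import Relation.Nullary.Decidable using (decidable-stable)

ℕ→ℚ≡mkℚ : ∀ m → ℕ→ℚ m ≡ mkℚ (ℤ.+ m) 0 (coprime-sym (1-coprimeTo m))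
ℕ→ℚ≡mkℚ m = normalize-coprime (coprime-sym (1-coprimeTo m))

ℕ→ℚ-mono-≤ : ∀ {m n} → m ℕ.≤ n → ℕ→ℚ m ≤ ℕ→ℚ n
ℕ→ℚ-mono-≤ {m} {n} m≤n rewrite ℕ→ℚ≡mkℚ m | ℕ→ℚ≡mkℚ n = *≤* (ℤ.*-monoʳ-≤-nonNeg 1ℤ (ℤ.+≤+ m≤n))

ℕ→ℚ-+ : ∀ m n → ℕ→ℚ (m ℕ.+ n) ≡ ℕ→ℚ m + ℕ→ℚ n
ℕ→ℚ-+ m n = toℚᵘ-injective (begin
  toℚᵘ (ℕ→ℚ (m ℕ.+ n))                   ≡⟨ cong toℚᵘ (ℕ→ℚ≡mkℚ (m ℕ.+ n)) ⟩
  mkℚᵘ (ℤ.+ (m ℕ.+ n)) 0                  ≈⟨ *≡* (cong (ℤ._* 1ℤ) m+n≡m*1+n*1) ⟩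
  mkℚᵘ (ℤ.+ m) 0 ℚᵘ.+ mkℚᵘ (ℤ.+ n) 0      ≡⟨ cong₂ ℚᵘ._+_ (cong toℚᵘ (ℕ→ℚ≡mkℚ m)) (cong toℚᵘ (ℕ→ℚ≡mkℚ n)) ⟨
  toℚᵘ (ℕ→ℚ m) ℚᵘ.+ toℚᵘ (ℕ→ℚ n)          ≈⟨ toℚᵘ-homo-+ (ℕ→ℚ m) (ℕ→ℚ n) ⟨
  toℚᵘ (ℕ→ℚ m + ℕ→ℚ n)                   ∎)
  where
  open ≃-Reasoning
  m+n≡m*1+n*1 : ℤ.+ (m ℕ.+ n) ≡ (ℤ.+ m) ℤ.* 1ℤ ℤ.+ (ℤ.+ n) ℤ.* 1ℤ
  m+n≡m*1+n*1 = trans (ℤ.pos-+ m n) (sym (cong₂ ℤ._+_ (ℤ.*-identityʳ (ℤ.+ m)) (ℤ.*-identityʳ (ℤ.+ n))))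

+-cancelʳ-< : ∀ r {p q} → p + r < q + r → p < q
+-cancelʳ-< r {p} {q} p+r<q+r = begin-strict
  p            ≡⟨ [x+r]-r≡x p ⟨
  p + r + - r  <⟨ +-monoˡ-< (- r) p+r<q+r ⟩
  q + r + - r  ≡⟨ [x+r]-r≡x q ⟩
  q            ∎
  where
  open ≤-Reasoning
  [x+r]-r≡x : ∀ x → x + r + - r ≡ x
  [x+r]-r≡x x = trans (+-assoc x r (- r)) (trans (cong (x +_) (+-inverseʳ r)) (+-identityʳ x))

a+b≤D+4φ⇒[1+η]2φ<D : ∀ φ η {a b D} → (ℕ→ℚ 3 + η) * φ < a → (ℕ→ℚ 3 + η) * φ < b →
  a + b ≤ D + ((φ + φ) + (φ + φ)) → (1ℚ + η) * (ℕ→ℚ 2 * φ) < D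
a+b≤D+4φ⇒[1+η]2φ<D φ η {a} {b} {D} φ<a φ<b a+b≤ = +-cancelʳ-< ((φ + φ) + (φ + φ)) (begin-strict
  (1ℚ + η) * (ℕ→ℚ 2 * φ) + ((φ + φ) + (φ + φ))  ≡⟨ rearrange φ η ⟩
  (ℕ→ℚ 3 + η) * φ + (ℕ→ℚ 3 + η) * φ            <⟨ +-mono-< φ<a φ<b ⟩
  a + b                                         ≤⟨ a+b≤ ⟩
  D + ((φ + φ) + (φ + φ))                       ∎)
  where
  open ≤-Reasoning
  open +-*-Solver using (solve; con; _:+_; _:*_; _:=_)
  rearrange : ∀ φ η → (1ℚ + η) * (ℕ→ℚ 2 * φ) + ((φ + φ) + (φ + φ)) ≡ (ℕ→ℚ 3 + η) * φ + (ℕ→ℚ 3 + η) * φ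
  rearrange = solve 2 (λ φ η → (con 1ℚ :+ η) :* (con (ℕ→ℚ 2) :* φ) :+ ((φ :+ φ) :+ (φ :+ φ))
                               := (con (ℕ→ℚ 3) :+ η) :* φ :+ (con (ℕ→ℚ 3) :+ η) :* φ) refl

module ClusterPhi {n} (G : Graph n) (φ η : ℚ) {C : Clustering n} (obj : ObjAtMost G C φ) where

  ρ+ρ≤φ+φ : ∀ x y → ℕ→ℚ (ρ G C x ℕ.+ ρ G C y) ≤ φ + φ
  ρ+ρ≤φ+φ x y = begin
    ℕ→ℚ (ρ G C x ℕ.+ ρ G C y)     ≡⟨ ℕ→ℚ-+ (ρ G C x) (ρ G C y) ⟩
    ℕ→ℚ (ρ G C x) + ℕ→ℚ (ρ G C y) ≤⟨ +-mono-≤ (obj x) (obj y) ⟩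
    φ + φ                          ∎
    where open ≤-Reasoning

  sameCluster⇒close : ∀ {x y} → C x ≡ C y → ℕ→ℚ (nbDiff G x y) ≤ ℕ→ℚ 2 * φ
  sameCluster⇒close {x} {y} Cx≡Cy = begin
    ℕ→ℚ (nbDiff G x y)         ≤⟨ ℕ→ℚ-mono-≤ (sameCluster⇒nbDiff≤ρ+ρ G Cx≡Cy) ⟩
    ℕ→ℚ (ρ G C x ℕ.+ ρ G C y) ≤⟨ ρ+ρ≤φ+φ x y ⟩
    φ + φ                      ≡⟨ cong₂ _+_ (*-identityˡ φ) (*-identityˡ φ) ⟨
    1ℚ * φ + 1ℚ * φ            ≡⟨ *-distribʳ-+ φ 1ℚ 1ℚ ⟨
    ℕ→ℚ 2 * φ                  ∎
    where open ≤-Reasoning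

  high⇒[3+η]φ<∣N[]∣ : ∀ {x} → High G φ η x → (ℕ→ℚ 3 + η) * φ < ℕ→ℚ ∣ N[_] G x ∣
  high⇒[3+η]φ<∣N[]∣ {x} high = <-≤-trans high (ℕ→ℚ-mono-≤ (deg≤∣N[]∣ G x))

  differentClusters⇒far : ∀ {x y} → High G φ η x → High G φ η y → C x ≢ C y →
                          (1ℚ + η) * (ℕ→ℚ 2 * φ) < ℕ→ℚ (nbDiff G x y)
  differentClusters⇒far {x} {y} highˣ highʸ Cx≢Cy =
    a+b≤D+4φ⇒[1+η]2φ<D φ η (high⇒[3+η]φ<∣N[]∣ highˣ) (high⇒[3+η]φ<∣N[]∣ highʸ) (begin
      ℕ→ℚ ∣ N[_] G x ∣ + ℕ→ℚ ∣ N[_] G y ∣   ≡⟨ ℕ→ℚ-+ ∣ N[_] G x ∣ ∣ N[_] G y ∣ ⟨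
      ℕ→ℚ (∣ N[_] G x ∣ ℕ.+ ∣ N[_] G y ∣)  ≤⟨ ℕ→ℚ-mono-≤ separation ⟩
      ℕ→ℚ (D ℕ.+ (e ℕ.+ e))                ≡⟨ ℕ→ℚ-+ D (e ℕ.+ e) ⟩
      ℕ→ℚ D + ℕ→ℚ (e ℕ.+ e)                ≡⟨ cong (ℕ→ℚ D +_) (ℕ→ℚ-+ e e) ⟩
      ℕ→ℚ D + (ℕ→ℚ e + ℕ→ℚ e)              ≤⟨ +-monoʳ-≤ (ℕ→ℚ D) (+-mono-≤ (ρ+ρ≤φ+φ x y) (ρ+ρ≤φ+φ x y)) ⟩
      ℕ→ℚ D + ((φ + φ) + (φ + φ))          ∎)
    where
    open ≤-Reasoning
    D e : ℕ
    D = nbDiff G x y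
    e = ρ G C x ℕ.+ ρ G C y
    separation : ∣ N[_] G x ∣ ℕ.+ ∣ N[_] G y ∣ ℕ.≤ D ℕ.+ (e ℕ.+ e)
    separation = ∣p∣+∣q∣≤∣pΔq∣+2[∣pΔr∣+∣qΔs∣] (N[_] G x) (N[_] G y) (cluster C x) (cluster C y)
                   (cluster-disjoint Cx≢Cy)

  module _ {E' : Rel (Fin n) 0ℓ} where

    Reach⇒High : ∀ {u w} → High G φ η u → Reach G φ η E' u w → High G φ η w
    Reach⇒High highᵘ here           = highᵘ
    Reach⇒High _     (step _ _ highʷ) = highʷ

    Reach⇒sameCluster : (∀ x y → (1ℚ + η) * (ℕ→ℚ 2 * φ) < ℕ→ℚ (nbDiff G x y) → ¬ E' x y) →
                        ∀ {u w} → High G φ η u → Reach G φ η E' u w → C w ≡ C u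
    Reach⇒sameCluster far⇒¬E' highᵘ here                 = refl
    Reach⇒sameCluster far⇒¬E' highᵘ (step {v} {w} r e highʷ) =
      trans (sym Cv≡Cw) (Reach⇒sameCluster far⇒¬E' highᵘ r)
      where
      Cv≡Cw : C v ≡ C w
      Cv≡Cw = decidable-stable (C v ℕ.≟ C w)
                (λ Cv≢Cw → far⇒¬E' v w (differentClusters⇒far (Reach⇒High highᵘ r) highʷ Cv≢Cw) e)

    sameCluster⇒Reach : (∀ x y → ℕ→ℚ (nbDiff G x y) ≤ ℕ→ℚ 2 * φ → E' x y) →
                        ∀ {u v} → High G φ η v → C v ≡ C u → Reach G φ η E' u v
    sameCluster⇒Reach close⇒E' highᵛ Cv≡Cu = step here (close⇒E' _ _ (sameCluster⇒close (sym Cv≡Cu))) highᵛ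

mainTheorem2 : ∀ {n : ℕ} (G : Graph n) (φ η : ℚ) → 0ℚ ≤ φ → 0ℚ ≤ η → η < 1ℚ
    → (Cstar : Clustering n) → ObjAtMost G Cstar φ
    → (E' : Rel (Fin n) 0ℓ) → ValidE' G φ η E'
    → ∀ u → High G φ η u → ∀ v → High G φ η v
    → (Reach G φ η E' u v ⇔ Cstar v ≡ Cstar u)
mainTheorem2 G φ η _ _ _ _ obj _ (_ , close⇒E' , far⇒¬E') _ highᵘ _ highᵛ =
  mk⇔ (Reach⇒sameCluster far⇒¬E' highᵘ) (sameCluster⇒Reach close⇒E' highᵛ)
  where open ClusterPhi G φ η obj
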